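{- Let $N$ be a finite set and $\mathcal{F}\subseteq 2^N$ a family such that whenever $X,Y\in\mathcal{F}$ and $X\subsetneq Y$, there exists $j\in Y\setminus X$ with $X\cup\{j\}\in\mathcal{F}$ and $Y\setminus\{j\}\in\mathcal{F}$. Then for all $X,Y\in\mathcal{F}$ and every $Z$ with $X\subseteq Z\subseteq Y$, we have $Z\in\mathcal{F}$. -}

module Defs where

open import Data.Nat using (ℕ)
open import Data.Fin using (Fin)
open import Data.Product using (∃; _×_)
open import Data.Fin.Subset using (Subset; _∈_; _∉_; _⊂_; _∪_; _─_; ⁅_⁆)

ExchangeProperty : ∀ {n} → (Subset n → Set) → Set
ExchangeProperty {n} F =
  ∀ (X Y : Subset n) → F X → F Y → X ⊂ Y →
  ∃ λ (j : Fin n) → j ∈ Y × j ∉ X × F (X ∪ ⁅ j ⁆) × F (Y ─ ⁅ j ⁆)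

-- Walk the two ends of the interval towards Z. If X ⊊ Y, the exchange
-- property yields j ∈ Y ∖ X with X ∪ {j} and Y ∖ {j} in F; when j ∈ Z replace
-- X by X ∪ {j}, otherwise replace Y by Y ∖ {j}. Both keep X ⊆ Z ⊆ Y and shrink
-- ∣Y∣ − ∣X∣, so the walk ends with X = Y = Z.
module Submission where

open import Defs
open import Data.Nat using (ℕ; zero; suc; _+_; _≤_; _<_)
open import Data.Nat.Properties using (module ≤-Reasoning; ≤-pred; <-≤-trans; <⇒≱; +-suc; +-monoʳ-≤; m≤m+n)
open import Data.Fin using (Fin)
open import Data.Fin.Subset
open import Data.Fin.Subset.Properties
open import Data.Product using (_,_)
open import Data.Sum using (_⊎_; inj₁; inj₂; [_,_]′)
open import Relation.Nullary using (yes; no; contradiction)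
open import Relation.Binary.PropositionalEquality using (_≡_; refl; subst; sym)

private
  variable
    n : ℕ
    p q r : Subset n
    x : Fin n

⊆⇒⊂⊎≡ : p ⊆ q → p ⊂ q ⊎ p ≡ q
⊆⇒⊂⊎≡ {p = p} {q} p⊆q with p ⊂? q
... | yes p⊂q = inj₁ p⊂q
... | no  p⊄q = inj₂ (⊆-antisym p⊆q q⊆p)
  where
  q⊆p : q ⊆ p
  q⊆p {x} x∈q with x ∈? p
  ... | yes x∈p = x∈p
  ... | no  x∉p = contradiction p⊂q p⊄q
    where
    p⊂q : p ⊂ q
    p⊂q = p⊆q , x , x∈q , x∉p

p⊆r∧q⊆r⇒p∪q⊆r : ∀ (p q : Subset n) → p ⊆ r → q ⊆ r → p ∪ q ⊆ r
p⊆r∧q⊆r⇒p∪q⊆r p q p⊆r q⊆r x∈p∪q = [ p⊆r , q⊆r ]′ (x∈p∪q⁻ p q x∈p∪q)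

x∈p⇒⁅x⁆⊆p : x ∈ p → ⁅ x ⁆ ⊆ p
x∈p⇒⁅x⁆⊆p {x = x} {p} x∈p y∈⁅x⁆ = subst (_∈ p) (sym (x∈⁅y⁆⇒x≡y x y∈⁅x⁆)) x∈p

r⊆p∧x∉r⇒r⊆p-x : r ⊆ p → x ∉ r → r ⊆ p - x
r⊆p∧x∉r⇒r⊆p-x {r = r} {x = x} r⊆p x∉r y∈r =
  x∈p∧x∉q⇒x∈p─q (r⊆p y∈r) (λ y∈⁅x⁆ → x∉r (subst (_∈ r) (x∈⁅y⁆⇒x≡y x y∈⁅x⁆) y∈r))

x∉p⇒∣p∣<∣p∪⁅x⁆∣ : x ∉ p → ∣ p ∣ < ∣ p ∪ ⁅ x ⁆ ∣
x∉p⇒∣p∣<∣p∪⁅x⁆∣ {x = x} x∉p =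
  p⊂q⇒∣p∣<∣q∣ (p⊆p∪q ⁅ x ⁆ , x , x∈p∪q⁺ (inj₂ (x∈⁅x⁆ x)) , x∉p)

module _ {F : Subset n → Set} (exchange : ExchangeProperty F) where

  interval-closed-≤ : ∀ m {X Y Z} → F X → F Y → X ⊆ Z → Z ⊆ Y →
                      ∣ Y ∣ ≤ m + ∣ X ∣ → F Z
  interval-closed-≤ m {X} {Y} {Z} fX fY X⊆Z Z⊆Y gap
    with ⊆⇒⊂⊎≡ (⊆-trans X⊆Z Z⊆Y)
  ... | inj₂ refl = subst F (⊆-antisym X⊆Z Z⊆Y) fX
  ... | inj₁ X⊂Y with exchange X Y fX fY X⊂Y | m
  ... | _ | zero = contradiction gap (<⇒≱ (p⊂q⇒∣p∣<∣q∣ X⊂Y))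
  ... | j , j∈Y , j∉X , fX∪j , fY-j | suc m with j ∈? Z
  ... | yes j∈Z = interval-closed-≤ m fX∪j fY
        (p⊆r∧q⊆r⇒p∪q⊆r X ⁅ j ⁆ X⊆Z (x∈p⇒⁅x⁆⊆p j∈Z)) Z⊆Y gap′
    where
    open ≤-Reasoning
    gap′ : ∣ Y ∣ ≤ m + ∣ X ∪ ⁅ j ⁆ ∣
    gap′ = begin
      ∣ Y ∣                ≤⟨ gap ⟩
      suc m + ∣ X ∣        ≡⟨ +-suc m ∣ X ∣ ⟨
      m + suc ∣ X ∣        ≤⟨ +-monoʳ-≤ m (x∉p⇒∣p∣<∣p∪⁅x⁆∣ j∉X) ⟩
      m + ∣ X ∪ ⁅ j ⁆ ∣    ∎
  ... | no j∉Z = interval-closed-≤ m fX fY-j X⊆Z (r⊆p∧x∉r⇒r⊆p-x Z⊆Y j∉Z)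
        (≤-pred (<-≤-trans (x∈p⇒∣p-x∣<∣p∣ j∈Y) gap))

lemma3p7 : (n : ℕ) (F : Subset n → Set) → ExchangeProperty F →
    ∀ (X Y Z : Subset n) → F X → F Y → X ⊆ Z → Z ⊆ Y → F Z
lemma3p7 n F exchange X Y Z fX fY X⊆Z Z⊆Y =
  interval-closed-≤ exchange ∣ Y ∣ fX fY X⊆Z Z⊆Y (m≤m+n ∣ Y ∣ ∣ X ∣)
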